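{- Let $G$ be a $(k_G,t_G)$-star colorable graph and $H$ a $(k_H,t_H)$-star colorable graph, where $t_G\geq \chi(H)$ and $t_H\geq\chi(G)$. Then $G\square H$ is $(k_G+k_H,\min\{t_G,t_H\})$-star colorable.
   Context: All graphs are finite, simple and undirected. A star edge coloring of a graph is a proper edge coloring such that no path or cycle with four edges uses at most two colors. $\chi$ denotes the chromatic number. For an edge coloring $f$ and a vertex $v$, $A_f(v)$ denotes the set of colors of edges incident to $v$. Two star edge colorings $f_1,f_2$ of $G$ are star compatible if $A_{f_1}(v)\cap A_{f_2}(v)=\emptyset$ for every vertex $v$. $G$ is $(k,t)$-star colorable if $G$ has $t$ pairwise star compatible star edge colorings $f_i:E(G)\to\{0,1,\ldots,k-1\}$, $1\le i\le t$. The Cartesian product $G\square H$ has vertex set $V(G)\times V(H)$, with $(a,x)(b,y)$ an edge iff either $ab\in E(G)$ and $x=y$, or $xy\in E(H)$ and $a=b$. -}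

module Defs where

open import Level using (0ℓ)
open import Data.Nat using (ℕ; _*_; _<_)
open import Data.Fin using (Fin)
open import Data.Fin.Properties using (*↔×)
open import Data.Product using (Σ; ∃; ∃-syntax; _×_; _,_)
open import Data.Sum using (_⊎_; inj₁; inj₂)
open import Data.Empty using (⊥)
open import Relation.Nullary using (¬_)
open import Relation.Binary.PropositionalEquality using (_≡_; _≢_; refl; sym)
open import Function.Bundles using (_↔_)
open import Function.Properties.Inverse using (↔-sym; ↔-trans)
open import Data.Product.Function.NonDependent.Propositional using (_×-↔_)

record Graph : Set₁ where
  field
    V        : Set
    size     : ℕ
    enum     : V ↔ Fin size
    Adj      : V → V → Set
    Adj-sym  : ∀ {u v} → Adj u v → Adj v u
    Adj-irr  : ∀ {v} → ¬ Adj v v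
open Graph public

_□_ : Graph → Graph → Graph
G □ H = record
  { V = V G × V H
  ; size = size G * size H
  ; enum = ↔-trans (enum G ×-↔ enum H) (↔-sym *↔×)
  ; Adj = λ { (a , x) (b , y) → (Adj G a b × x ≡ y) ⊎ (a ≡ b × Adj H x y) }
  ; Adj-sym = λ { (inj₁ (p , e)) → inj₁ (Adj-sym G p , sym e)
                ; (inj₂ (e , p)) → inj₂ (sym e , Adj-sym H p) }
  ; Adj-irr = λ { (inj₁ (p , _)) → Adj-irr G p ; (inj₂ (_ , p)) → Adj-irr H p }
  }

Colorable : Graph → ℕ → Set
Colorable G c = Σ (V G → Fin c) λ col → ∀ {u v} → Adj G u v → col u ≢ col v

IsChromaticNumber : Graph → ℕ → Set
IsChromaticNumber G χ = Colorable G χ × (∀ c → c < χ → ¬ Colorable G c)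

-- An edge colouring with colours {0,…,k-1}: a function on ordered pairs whose
-- values on edges are symmetric (values on non-edges are irrelevant).
record EdgeColoring (G : Graph) (k : ℕ) : Set where
  field
    col     : V G → V G → Fin k
    col-sym : ∀ {u v} → Adj G u v → col u v ≡ col v u
open EdgeColoring public

Proper : ∀ {G k} → EdgeColoring G k → Set
Proper {G} f = ∀ {u v w} → Adj G v u → Adj G v w → u ≢ w → col f v u ≢ col f v w

Path4 : (G : Graph) → V G → V G → V G → V G → V G → Set
Path4 G v0 v1 v2 v3 v4 =
  Adj G v0 v1 × Adj G v1 v2 × Adj G v2 v3 × Adj G v3 v4 ×
  v0 ≢ v1 × v0 ≢ v2 × v0 ≢ v3 × v0 ≢ v4 ×
  v1 ≢ v2 × v1 ≢ v3 × v1 ≢ v4 ×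
  v2 ≢ v3 × v2 ≢ v4 ×
  v3 ≢ v4

Cycle4 : (G : Graph) → V G → V G → V G → V G → Set
Cycle4 G v0 v1 v2 v3 =
  Adj G v0 v1 × Adj G v1 v2 × Adj G v2 v3 × Adj G v3 v0 ×
  v0 ≢ v1 × v0 ≢ v2 × v0 ≢ v3 × v1 ≢ v2 × v1 ≢ v3 × v2 ≢ v3

AtMostTwoColors : ∀ {G k} → EdgeColoring G k → V G → V G → V G → V G → V G → Set
AtMostTwoColors {k = k} f v0 v1 v2 v3 v4 =
  ∃[ a ] ∃[ b ] (In (col f v0 v1) a b × In (col f v1 v2) a b ×
                 In (col f v2 v3) a b × In (col f v3 v4) a b)
  where
  In : Fin k → Fin k → Fin k → Set
  In c a b = c ≡ a ⊎ c ≡ b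

IsStarEdgeColoring : ∀ {G k} → EdgeColoring G k → Set
IsStarEdgeColoring {G} f =
  Proper f ×
  (∀ v0 v1 v2 v3 v4 → Path4 G v0 v1 v2 v3 v4 → ¬ AtMostTwoColors f v0 v1 v2 v3 v4) ×
  (∀ v0 v1 v2 v3 → Cycle4 G v0 v1 v2 v3 → ¬ AtMostTwoColors f v0 v1 v2 v3 v0)

StarCompatible : ∀ {G k} → EdgeColoring G k → EdgeColoring G k → Set
StarCompatible {G} f g =
  ∀ v u w → Adj G v u → Adj G v w → col f v u ≢ col g v w

StarColorable : Graph → ℕ → ℕ → Set
StarColorable G k t =
  Σ (Fin t → EdgeColoring G k) λ f →
    (∀ i → IsStarEdgeColoring (f i)) ×
    (∀ i j → i ≢ j → StarCompatible (f i) (f j))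

-- Let f₀,…,f_{tG-1} be pairwise star compatible star edge colourings of G and
-- g₀,…,g_{tH-1} those of H.  A schedule κG : V H → Fin tG, κH : V G → Fin tH
-- colours G □ H: the G-edges of the fibre over x by f_{κG x}, the H-edges of the
-- fibre over a by g_{κH a}, using disjoint palettes inside kG + kH colours.
--   * For proper schedules this is a star colouring.  A two-coloured 4-edge walk
--     in a proper colouring alternates, so its first and third edges share a
--     colour, hence a kind.  It cannot change fibres: the two G-edges around an
--     H-edge xy are coloured by f_{κG x} and f_{κG y}, compatible at their common
--     vertex.  Inside a fibre it contradicts the star property of the fibre.
--   * Schedules differing at every vertex give compatible colourings.
module Submission where

open import Defs
open import Data.Nat using (ℕ; _≤_; _+_; _⊓_; _<_; _*_; _∸_; suc; NonZero)
open import Data.Nat.Properties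
  using (m⊓n≤m; m⊓n≤n; m≤m*n; m+[n∸m]≡n; +-assoc; +-comm)
open import Data.Nat.DivMod using (_%_; _mod_; m<n⇒m%n≡m; [m+kn]%n≡m%n; %-distribˡ-+)
open import Data.Fin using (Fin; toℕ; inject≤; _↑ˡ_; _↑ʳ_; splitAt)
open import Data.Fin.Properties
  using (toℕ<n; toℕ-fromℕ<; toℕ-injective; inject≤-injective; ↑ˡ-injective; ↑ʳ-injective;
         splitAt-↑ˡ; splitAt-↑ʳ; inj⇒≟)
open import Data.Product using (_×_; _,_; proj₁; proj₂)
open import Data.Sum using (_⊎_; inj₁; inj₂)
open import Data.Empty using (⊥-elim)
open import Function using (_∘_)
open import Function.Properties.Inverse using (↔⇒↣)
open import Relation.Nullary using (¬_; yes; no; contradiction)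
open import Relation.Binary.Definitions using (DecidableEquality)
open import Relation.Binary.PropositionalEquality
  using (_≡_; _≢_; refl; sym; trans; cong; module ≡-Reasoning)

vertex-≟ : (G : Graph) → DecidableEquality (V G)
vertex-≟ G = inj⇒≟ (↔⇒↣ (enum G))

↑ˡ≢↑ʳ : ∀ {m n} (i : Fin m) (j : Fin n) → i ↑ˡ n ≢ m ↑ʳ j
↑ˡ≢↑ʳ {m} {n} i j eq
  with () ← trans (sym (splitAt-↑ˡ m i n)) (trans (cong (splitAt m) eq) (splitAt-↑ʳ m n j))

-- Addition is cancellative modulo n on the residues 0,…,n-1: subtracting c
-- is adding c·n − c, which is invisible modulo n.
+-%-cancelʳ : ∀ {n a b} c .{{_ : NonZero n}} → a < n → b < n →
  (a + c) % n ≡ (b + c) % n → a ≡ b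
+-%-cancelʳ {n} {a} {b} c a<n b<n eq = begin
  a                                    ≡⟨ unshift a<n ⟩
  ((a + c) % n + (c * n ∸ c) % n) % n  ≡⟨ cong (λ r → (r + (c * n ∸ c) % n) % n) eq ⟩
  ((b + c) % n + (c * n ∸ c) % n) % n  ≡⟨ sym (unshift b<n) ⟩
  b                                    ∎
  where
  open ≡-Reasoning
  unshift : ∀ {m} → m < n → m ≡ ((m + c) % n + (c * n ∸ c) % n) % n
  unshift {m} m<n = begin
    m                                    ≡⟨ sym (m<n⇒m%n≡m m<n) ⟩
    m % n                                ≡⟨ sym ([m+kn]%n≡m%n m c n) ⟩
    (m + c * n) % n                      ≡⟨ cong (λ k → (m + k) % n) (sym (m+[n∸m]≡n (m≤m*n c n))) ⟩
    (m + (c + (c * n ∸ c))) % n          ≡⟨ cong (_% n) (sym (+-assoc m c _)) ⟩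
    (m + c + (c * n ∸ c)) % n            ≡⟨ %-distribˡ-+ (m + c) _ n ⟩
    ((m + c) % n + (c * n ∸ c) % n) % n  ∎

-- The cyclic group ℤ/n on Fin n; all we need is that it is a Latin square.
_⊕_ : ∀ {n} → Fin n → Fin n → Fin n
_⊕_ {suc n} i j = (toℕ i + toℕ j) mod suc n

⊕-cancelʳ : ∀ {n} {i j : Fin n} (k : Fin n) → i ⊕ k ≡ j ⊕ k → i ≡ j
⊕-cancelʳ {suc n} {i} {j} k eq = toℕ-injective (+-%-cancelʳ (toℕ k) (toℕ<n i) (toℕ<n j) residues)
  where
  residues : (toℕ i + toℕ k) % suc n ≡ (toℕ j + toℕ k) % suc n
  residues = trans (sym (toℕ-fromℕ< _)) (trans (cong toℕ eq) (toℕ-fromℕ< _))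

⊕-comm : ∀ {n} (i j : Fin n) → i ⊕ j ≡ j ⊕ i
⊕-comm {suc n} i j = cong (_mod suc n) (+-comm (toℕ i) (toℕ j))

⊕-cancelˡ : ∀ {n} (i : Fin n) {j k : Fin n} → i ⊕ j ≡ i ⊕ k → j ≡ k
⊕-cancelˡ i {j} {k} eq = ⊕-cancelʳ i (trans (⊕-comm j i) (trans eq (⊕-comm i k)))

record ColouringFamily (H : Graph) (t s : ℕ) : Set where
  field
    colouring : Fin s → V H → Fin t
    proper    : ∀ i {x y} → Adj H x y → colouring i x ≢ colouring i y
    distinct  : ∀ {i j} → i ≢ j → ∀ x → colouring i x ≢ colouring j x

shifted-family : ∀ {H χ t s} → Colorable H χ → χ ≤ t → s ≤ t → ColouringFamily H t s
shifted-family {H} {χ} {t} {s} (c , c-proper) χ≤t s≤t = record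
  { colouring = shift
  ; proper    = λ i xy eq → c-proper xy (inject≤-injective χ≤t χ≤t _ _ (⊕-cancelʳ (index i) eq))
  ; distinct  = λ i≢j x eq → i≢j (inject≤-injective s≤t s≤t _ _ (⊕-cancelˡ (base x) eq))
  }
  where
  base : V H → Fin t
  base x = inject≤ (c x) χ≤t
  index : Fin s → Fin t
  index i = inject≤ i s≤t
  shift : Fin s → V H → Fin t
  shift i x = base x ⊕ index i

consecutive-colours-differ : ∀ {G k} (f : EdgeColoring G k) → Proper f →
  ∀ {u v w} → Adj G u v → Adj G v w → u ≢ w → col f u v ≢ col f v w
consecutive-colours-differ {G} f f-proper uv vw u≢w eq =
  f-proper (Adj-sym G uv) vw u≢w (trans (sym (col-sym f uv)) eq)

Alternating : ∀ {G k} → EdgeColoring G k → V G → V G → V G → V G → V G → Set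
Alternating f v0 v1 v2 v3 v4 = col f v0 v1 ≡ col f v2 v3 × col f v1 v2 ≡ col f v3 v4

alternating⇒two-colours : ∀ {G k} (f : EdgeColoring G k) {v0 v1 v2 v3 v4} →
  Alternating f v0 v1 v2 v3 v4 → AtMostTwoColors f v0 v1 v2 v3 v4
alternating⇒two-colours f (e13 , e24) =
  _ , _ , inj₁ refl , inj₂ refl , inj₁ (sym e13) , inj₂ (sym e24)

outer-colours-agree : ∀ {A : Set} {α β p q r : A} →
  p ≡ α ⊎ p ≡ β → q ≡ α ⊎ q ≡ β → r ≡ α ⊎ r ≡ β → p ≢ q → q ≢ r → p ≡ r
outer-colours-agree (inj₁ p≡α) _          (inj₁ r≡α) _   _   = trans p≡α (sym r≡α)
outer-colours-agree (inj₂ p≡β) _          (inj₂ r≡β) _   _   = trans p≡β (sym r≡β)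
outer-colours-agree (inj₁ p≡α) (inj₁ q≡α) (inj₂ _)   p≢q _   = ⊥-elim (p≢q (trans p≡α (sym q≡α)))
outer-colours-agree (inj₁ _)   (inj₂ q≡β) (inj₂ r≡β) _   q≢r = ⊥-elim (q≢r (trans q≡β (sym r≡β)))
outer-colours-agree (inj₂ p≡β) (inj₂ q≡β) (inj₁ _)   p≢q _   = ⊥-elim (p≢q (trans p≡β (sym q≡β)))
outer-colours-agree (inj₂ _)   (inj₁ q≡α) (inj₁ r≡α) _   q≢r = ⊥-elim (q≢r (trans q≡α (sym r≡α)))

two-colours⇒alternating : ∀ {G k} (f : EdgeColoring G k) {v0 v1 v2 v3 v4} →
  AtMostTwoColors f v0 v1 v2 v3 v4 →
  col f v0 v1 ≢ col f v1 v2 → col f v1 v2 ≢ col f v2 v3 → col f v2 v3 ≢ col f v3 v4 →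
  Alternating f v0 v1 v2 v3 v4
two-colours⇒alternating f (_ , _ , c1 , c2 , c3 , c4) d12 d23 d34 =
  outer-colours-agree c1 c2 c3 d12 d23 , outer-colours-agree c2 c3 c4 d23 d34

module _ {G G′ : Graph} (ι : V G → V G′)
         (reflect : ∀ {a b} → Adj G′ (ι a) (ι b) → Adj G a b) where

  pull-Path4 : ∀ {a0 a1 a2 a3 a4} →
    Path4 G′ (ι a0) (ι a1) (ι a2) (ι a3) (ι a4) → Path4 G a0 a1 a2 a3 a4
  pull-Path4 (e1 , e2 , e3 , e4 , d01 , d02 , d03 , d04 , d12 , d13 , d14 , d23 , d24 , d34) =
    reflect e1 , reflect e2 , reflect e3 , reflect e4 ,
    d01 ∘ cong ι , d02 ∘ cong ι , d03 ∘ cong ι , d04 ∘ cong ι , d12 ∘ cong ι ,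
    d13 ∘ cong ι , d14 ∘ cong ι , d23 ∘ cong ι , d24 ∘ cong ι , d34 ∘ cong ι

  pull-Cycle4 : ∀ {a0 a1 a2 a3} → Cycle4 G′ (ι a0) (ι a1) (ι a2) (ι a3) → Cycle4 G a0 a1 a2 a3
  pull-Cycle4 (e1 , e2 , e3 , e4 , d01 , d02 , d03 , d12 , d13 , d23) =
    reflect e1 , reflect e2 , reflect e3 , reflect e4 ,
    d01 ∘ cong ι , d02 ∘ cong ι , d03 ∘ cong ι , d12 ∘ cong ι , d13 ∘ cong ι , d23 ∘ cong ι

pattern G-edge p = inj₁ (p , refl)
pattern H-edge q = inj₂ (refl , q)

module Product (G H : Graph) {kG kH tG tH : ℕ}
  (f : Fin tG → EdgeColoring G kG) (g : Fin tH → EdgeColoring H kH) where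

  W : Graph
  W = G □ H

  G-fibre-reflects : ∀ {x a b} → Adj W (a , x) (b , x) → Adj G a b
  G-fibre-reflects (inj₁ (p , _)) = p
  G-fibre-reflects (inj₂ (_ , q)) = ⊥-elim (Adj-irr H q)

  H-fibre-reflects : ∀ {a x y} → Adj W (a , x) (a , y) → Adj H x y
  H-fibre-reflects (inj₁ (p , _)) = ⊥-elim (Adj-irr G p)
  H-fibre-reflects (inj₂ (_ , q)) = q

  data InFibre : V W → V W → V W → V W → V W → Set where
    G-fibre : ∀ x {a0 a1 a2 a3 a4} → InFibre (a0 , x) (a1 , x) (a2 , x) (a3 , x) (a4 , x)
    H-fibre : ∀ a {x0 x1 x2 x3 x4} → InFibre (a , x0) (a , x1) (a , x2) (a , x3) (a , x4)

  colour : (V H → Fin tG) → (V G → Fin tH) → V W → V W → Fin (kG + kH)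
  colour κG κH (a , x) (b , y) with vertex-≟ H x y
  ... | yes _ = col (f (κG x)) a b ↑ˡ kH
  ... | no  _ = kG ↑ʳ col (g (κH a)) x y

  module _ {κG : V H → Fin tG} {κH : V G → Fin tH} where

    colour-G : ∀ {a b x} → colour κG κH (a , x) (b , x) ≡ col (f (κG x)) a b ↑ˡ kH
    colour-G {x = x} with vertex-≟ H x x
    ... | yes _   = refl
    ... | no  x≢x = contradiction refl x≢x

    colour-H : ∀ {a x y} → Adj H x y → colour κG κH (a , x) (a , y) ≡ kG ↑ʳ col (g (κH a)) x y
    colour-H {x = x} {y} xy with vertex-≟ H x y
    ... | yes refl = ⊥-elim (Adj-irr H xy)
    ... | no  _    = refl

    colour-sym : ∀ {u v} → Adj W u v → colour κG κH u v ≡ colour κG κH v u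
    colour-sym (G-edge p) = trans colour-G (trans (cong (_↑ˡ kH) (col-sym (f _) p)) (sym colour-G))
    colour-sym (H-edge q) =
      trans (colour-H q) (trans (cong (kG ↑ʳ_) (col-sym (g _) q)) (sym (colour-H (Adj-sym H q))))

  colouring : (V H → Fin tG) → (V G → Fin tH) → EdgeColoring W (kG + kH)
  colouring κG κH = record { col = colour κG κH ; col-sym = colour-sym }

  module _ {κG κG′ : V H → Fin tG} {κH κH′ : V G → Fin tH} where

    G-colours-agree : ∀ {a b c d x y} →
      colour κG κH (a , x) (b , x) ≡ colour κG′ κH′ (c , y) (d , y) →
      col (f (κG x)) a b ≡ col (f (κG′ y)) c d
    G-colours-agree eq = ↑ˡ-injective kH _ _ (trans (sym colour-G) (trans eq colour-G))

    H-colours-agree : ∀ {a b x y z w} → Adj H x y → Adj H z w →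
      colour κG κH (a , x) (a , y) ≡ colour κG′ κH′ (b , z) (b , w) →
      col (g (κH a)) x y ≡ col (g (κH′ b)) z w
    H-colours-agree xy zw eq = ↑ʳ-injective kG _ _ (trans (sym (colour-H xy)) (trans eq (colour-H zw)))

    G≢H : ∀ {a b c x y z} → Adj H y z →
      colour κG κH (a , x) (b , x) ≢ colour κG′ κH′ (c , y) (c , z)
    G≢H yz eq = ↑ˡ≢↑ʳ _ _ (trans (sym colour-G) (trans eq (colour-H yz)))

  -- Properness is inherited from the fibre colourings and the disjoint palettes.
  colouring-proper : ∀ {κG κH} → (∀ i → Proper (f i)) → (∀ i → Proper (g i)) →
    Proper (colouring κG κH)
  colouring-proper f-proper g-proper (G-edge p) (G-edge p′) u≢w eq =
    f-proper _ p p′ (u≢w ∘ cong (_, _)) (G-colours-agree eq)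
  colouring-proper f-proper g-proper (G-edge p) (H-edge q) _ = G≢H q
  colouring-proper f-proper g-proper (H-edge q) (G-edge p) _ = G≢H q ∘ sym
  colouring-proper f-proper g-proper (H-edge q) (H-edge q′) u≢w eq =
    g-proper _ q q′ (u≢w ∘ cong (_ ,_)) (H-colours-agree q q′ eq)

  colouring-compatible : ∀ {κG κG′ κH κH′} →
    (∀ i j → i ≢ j → StarCompatible (f i) (f j)) →
    (∀ i j → i ≢ j → StarCompatible (g i) (g j)) →
    (∀ x → κG x ≢ κG′ x) → (∀ a → κH a ≢ κH′ a) →
    StarCompatible (colouring κG κH) (colouring κG′ κH′)
  colouring-compatible f-compat g-compat κG≢κG′ κH≢κH′ (a , x) _ _ (G-edge p) (G-edge p′) eq =
    f-compat _ _ (κG≢κG′ x) a _ _ p p′ (G-colours-agree eq)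
  colouring-compatible f-compat g-compat κG≢κG′ κH≢κH′ _ _ _ (G-edge p) (H-edge q) = G≢H q
  colouring-compatible f-compat g-compat κG≢κG′ κH≢κH′ _ _ _ (H-edge q) (G-edge p) = G≢H q ∘ sym
  colouring-compatible f-compat g-compat κG≢κG′ κH≢κH′ (a , x) _ _ (H-edge q) (H-edge q′) eq =
    g-compat _ _ (κH≢κH′ a) x _ _ q q′ (H-colours-agree q q′ eq)

  module Star {κG : V H → Fin tG} {κH : V G → Fin tH}
    (f-star : ∀ i → IsStarEdgeColoring (f i)) (g-star : ∀ i → IsStarEdgeColoring (g i))
    (f-compat : ∀ i j → i ≢ j → StarCompatible (f i) (f j))
    (g-compat : ∀ i j → i ≢ j → StarCompatible (g i) (g j))
    (κG-proper : ∀ {x y} → Adj H x y → κG x ≢ κG y)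
    (κH-proper : ∀ {a b} → Adj G a b → κH a ≢ κH b) where

    h : EdgeColoring W (kG + kH)
    h = colouring κG κH

    -- Two G-edges joined by an H-edge xy get different colours: they are
    -- coloured by f (κG x) and f (κG y), which are compatible at the common vertex.
    G-H-G-changes-colour : ∀ {a0 a1 a2 x y} → Adj G a0 a1 → Adj H x y → Adj G a1 a2 →
      colour κG κH (a0 , x) (a1 , x) ≢ colour κG κH (a1 , y) (a2 , y)
    G-H-G-changes-colour p xy p′ eq =
      f-compat _ _ (κG-proper xy) _ _ _ (Adj-sym G p) p′
        (trans (sym (col-sym (f _) p)) (G-colours-agree eq))

    H-G-H-changes-colour : ∀ {a b x0 x1 x2} → Adj H x0 x1 → Adj G a b → Adj H x1 x2 →
      colour κG κH (a , x0) (a , x1) ≢ colour κG κH (b , x1) (b , x2)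
    H-G-H-changes-colour q ab q′ eq =
      g-compat _ _ (κH-proper ab) _ _ _ (Adj-sym H q) q′
        (trans (sym (col-sym (g _) q)) (H-colours-agree q q′ eq))

    -- An alternating walk never leaves its fibre: edges of equal colour have the
    -- same kind, and a change of kind is excluded by the two lemmas above.
    alternating-walk-in-fibre : ∀ {v0 v1 v2 v3 v4} →
      Adj W v0 v1 → Adj W v1 v2 → Adj W v2 v3 → Adj W v3 v4 →
      Alternating h v0 v1 v2 v3 v4 → InFibre v0 v1 v2 v3 v4
    alternating-walk-in-fibre (G-edge _) (G-edge _)  (G-edge _)  (G-edge _) _ = G-fibre _
    alternating-walk-in-fibre (H-edge _) (H-edge _)  (H-edge _)  (H-edge _) _ = H-fibre _
    alternating-walk-in-fibre (G-edge p) (H-edge q)  (G-edge p′) _ (e13 , _) =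
      ⊥-elim (G-H-G-changes-colour p q p′ e13)
    alternating-walk-in-fibre (H-edge q) (G-edge p)  (H-edge q′) _ (e13 , _) =
      ⊥-elim (H-G-H-changes-colour q p q′ e13)
    alternating-walk-in-fibre (G-edge _) (G-edge _)  (H-edge q)  _ (e13 , _) = ⊥-elim (G≢H q e13)
    alternating-walk-in-fibre (G-edge _) (H-edge _)  (H-edge q)  _ (e13 , _) = ⊥-elim (G≢H q e13)
    alternating-walk-in-fibre (H-edge q) (H-edge _)  (G-edge _)  _ (e13 , _) = ⊥-elim (G≢H q (sym e13))
    alternating-walk-in-fibre (H-edge q) (G-edge _)  (G-edge _)  _ (e13 , _) = ⊥-elim (G≢H q (sym e13))
    alternating-walk-in-fibre (G-edge _) (G-edge _)  (G-edge _)  (H-edge q) (_ , e24) =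
      ⊥-elim (G≢H q e24)
    alternating-walk-in-fibre (H-edge _) (H-edge q)  (H-edge _)  (G-edge _) (_ , e24) =
      ⊥-elim (G≢H q (sym e24))

    G-fibre-two-colours : ∀ {x a0 a1 a2 a3 a4} →
      Alternating h (a0 , x) (a1 , x) (a2 , x) (a3 , x) (a4 , x) →
      AtMostTwoColors (f (κG x)) a0 a1 a2 a3 a4
    G-fibre-two-colours (e13 , e24) =
      alternating⇒two-colours (f (κG _)) (G-colours-agree e13 , G-colours-agree e24)

    H-fibre-two-colours : ∀ {a x0 x1 x2 x3 x4} →
      Adj W (a , x0) (a , x1) → Adj W (a , x1) (a , x2) →
      Adj W (a , x2) (a , x3) → Adj W (a , x3) (a , x4) →
      Alternating h (a , x0) (a , x1) (a , x2) (a , x3) (a , x4) →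
      AtMostTwoColors (g (κH a)) x0 x1 x2 x3 x4
    H-fibre-two-colours e1 e2 e3 e4 (e13 , e24) = alternating⇒two-colours (g (κH _))
      (H-colours-agree (H-fibre-reflects e1) (H-fibre-reflects e3) e13 ,
       H-colours-agree (H-fibre-reflects e2) (H-fibre-reflects e4) e24)

    fibre-path-not-alternating : ∀ {v0 v1 v2 v3 v4} → InFibre v0 v1 v2 v3 v4 →
      Path4 W v0 v1 v2 v3 v4 → ¬ Alternating h v0 v1 v2 v3 v4
    fibre-path-not-alternating (G-fibre x) P alt =
      proj₁ (proj₂ (f-star (κG x))) _ _ _ _ _ (pull-Path4 {G} {W} (_, x) G-fibre-reflects P)
        (G-fibre-two-colours alt)
    fibre-path-not-alternating (H-fibre a) P@(e1 , e2 , e3 , e4 , _) alt =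
      proj₁ (proj₂ (g-star (κH a))) _ _ _ _ _ (pull-Path4 {H} {W} (a ,_) H-fibre-reflects P)
        (H-fibre-two-colours e1 e2 e3 e4 alt)

    fibre-cycle-not-alternating : ∀ {v0 v1 v2 v3} → InFibre v0 v1 v2 v3 v0 →
      Cycle4 W v0 v1 v2 v3 → ¬ Alternating h v0 v1 v2 v3 v0
    fibre-cycle-not-alternating (G-fibre x) C alt =
      proj₂ (proj₂ (f-star (κG x))) _ _ _ _ (pull-Cycle4 {G} {W} (_, x) G-fibre-reflects C)
        (G-fibre-two-colours alt)
    fibre-cycle-not-alternating (H-fibre a) C@(e1 , e2 , e3 , e4 , _) alt =
      proj₂ (proj₂ (g-star (κH a))) _ _ _ _ (pull-Cycle4 {H} {W} (a ,_) H-fibre-reflects C)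
        (H-fibre-two-colours e1 e2 e3 e4 alt)

    -- A two-coloured 4-path or 4-cycle would alternate (h is proper), hence lie
    -- in a fibre, which is impossible.
    colouring-star : IsStarEdgeColoring h
    colouring-star = h-proper , no-path , no-cycle
      where
      h-proper : Proper h
      h-proper = colouring-proper (proj₁ ∘ f-star) (proj₁ ∘ g-star)

      differ : ∀ {u v w} → Adj W u v → Adj W v w → u ≢ w → col h u v ≢ col h v w
      differ = consecutive-colours-differ h h-proper

      no-path : ∀ v0 v1 v2 v3 v4 → Path4 W v0 v1 v2 v3 v4 → ¬ AtMostTwoColors h v0 v1 v2 v3 v4
      no-path v0 v1 v2 v3 v4 P@(e1 , e2 , e3 , e4 , _ , d02 , _ , _ , _ , d13 , _ , _ , d24 , _) two =
        fibre-path-not-alternating (alternating-walk-in-fibre e1 e2 e3 e4 alt) P alt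
        where
        alt : Alternating h v0 v1 v2 v3 v4
        alt = two-colours⇒alternating h two (differ e1 e2 d02) (differ e2 e3 d13) (differ e3 e4 d24)

      no-cycle : ∀ v0 v1 v2 v3 → Cycle4 W v0 v1 v2 v3 → ¬ AtMostTwoColors h v0 v1 v2 v3 v0
      no-cycle v0 v1 v2 v3 C@(e1 , e2 , e3 , e4 , _ , d02 , _ , _ , d13 , _) two =
        fibre-cycle-not-alternating (alternating-walk-in-fibre e1 e2 e3 e4 alt) C alt
        where
        alt : Alternating h v0 v1 v2 v3 v0
        alt = two-colours⇒alternating h two
                (differ e1 e2 d02) (differ e2 e3 d13) (differ e3 e4 (d02 ∘ sym))

theorem3 : (G H : Graph) (kG tG kH tH χG χH : ℕ) →
           StarColorable G kG tG → StarColorable H kH tH →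
           IsChromaticNumber G χG → IsChromaticNumber H χH →
           χH ≤ tG → χG ≤ tH →
           StarColorable (G □ H) (kG + kH) (tG ⊓ tH)
theorem3 G H kG tG kH tH χG χH (f , f-star , f-compat) (g , g-star , g-compat)
         (G-colourable , _) (H-colourable , _) χH≤tG χG≤tH =
  (λ i → colouring (κG i) (κH i)) ,
  (λ i → Star.colouring-star f-star g-star f-compat g-compat (κG-proper i) (κH-proper i)) ,
  (λ i j i≢j → colouring-compatible f-compat g-compat (κG-distinct i≢j) (κH-distinct i≢j))
  where
  open Product G H f g
  open ColouringFamily (shifted-family {H} H-colourable χH≤tG (m⊓n≤m tG tH))
    renaming (colouring to κG; proper to κG-proper; distinct to κG-distinct)
  open ColouringFamily (shifted-family {G} G-colourable χG≤tH (m⊓n≤n tG tH))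
    renaming (colouring to κH; proper to κH-proper; distinct to κH-distinct)
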